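{- Let $D=\{e_1,\dots,e_d\}$ be a set with $d$ elements listed in this order. Then the nonempty subsets of $D$ can be ordered as $S_1,\dots,S_{2^d-1}$ so that $e_j\in S_i$ whenever $1\le j\le d$ and $i\equiv j\pmod d$, and $|S_i|\le|S_j|$ whenever $i\le j$. -}

-- Let σ shift the elements of a subset of {0, …, d-1} cyclically by one. If X contains p mod d then
-- σ X contains (p + 1) mod d, and σ preserves cardinality. So an orbit X, σ X, …, σ^(m-1) X (m the
-- least period of X) can be listed from any position p, provided X is first rotated so that it
-- contains p mod d: every later set then contains its own position. The enumeration repeatedly takes
-- a set of least cardinality among those not yet listed, lists its whole orbit, and continues at
-- position p + m. What is left is again closed under σ, and since each orbit has constant
-- cardinality, no smaller than anything left, the cardinalities never decrease.
module Submission where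

open import Data.Bool using (true)
import Data.Bool as Bool
open import Data.Fin using (Fin; zero; suc; toℕ; fromℕ<; cast)
open import Data.Fin.Properties using (toℕ-injective; toℕ-fromℕ<; toℕ<n; toℕ-cast; cast-involutive)
open import Data.Fin.Subset using (Subset; _∈_; ∣_∣; Nonempty; inside; outside)
import Data.List as List
open import Data.List using (List; []; _∷_; _++_; length; filter; applyUpTo; map)
open import Data.List.Extrema.Nat using (argmin; argmin-sel; f[argmin]≤f[⊤]; f[argmin]≤f[xs])
open import Data.List.Membership.Propositional using () renaming (_∈_ to _∈ₗ_; _∉_ to _∉ₗ_)
open import Data.List.Membership.Propositional.Properties
  using ( ∈-lookup; ∈-applyUpTo⁺; ∈-applyUpTo⁻; ∈-map⁺; ∈-map⁻; ∈-filter⁺; ∈-filter⁻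
        ; ∈-++⁺ˡ; ∈-++⁺ʳ; ∈-++⁻)
open import Data.List.Membership.Propositional.Properties.WithK using (unique∧set⇒bag)
open import Data.List.Properties using (filter-notAll; length-++; length-map)
open import Data.List.Relation.Binary.BagAndSetEquality using (_∼[_]_; set; ∼bag⇒↭)
open import Data.List.Relation.Binary.Disjoint.Propositional using (Disjoint)
open import Data.List.Relation.Binary.Permutation.Propositional.Properties using (↭-length)
open import Data.List.Relation.Unary.All as All using (All; []; _∷_)
open import Data.List.Relation.Unary.AllPairs using (AllPairs; []; _∷_)
import Data.List.Relation.Unary.AllPairs.Properties as AllPairs
open import Data.List.Relation.Unary.Any as Any using (here; there)
open import Data.List.Relation.Unary.Any.Properties using (lookup-index)
open import Data.List.Relation.Unary.Unique.Propositional using (Unique)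
import Data.List.Relation.Unary.Unique.Propositional.Properties as Unique
open import Data.Nat using (ℕ; zero; suc; _+_; _*_; _^_; _∸_; _≤_; _<_; s≤s; NonZero)
open import Data.Nat.DivMod
  using (_%_; _mod_; %-distribˡ-+; m%n%n≡m%n; [m+n]%n≡m%n; [m+kn]%n≡m%n; m<n⇒m%n≡m; n%n≡0; m%n<n)
open import Data.Nat.GeneralisedArithmetic using (fold; fold-+)
open import Data.Nat.Induction using (<-wellFounded)
open import Data.Nat.Properties
open import Data.Product using (Σ; ∃; _×_; _,_; proj₁; proj₂)
open import Data.Sum using (inj₁; inj₂)
open import Data.Vec using (Vec; []; _∷_; _∷ʳ_; lookup; tabulate; here; there)
open import Data.Vec.Properties
  using (tabulate∘lookup; tabulate-cong; lookup⇒[]=; []=⇒lookup; ≡-dec; ∷-injectiveʳ)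
open import Function using (_∘_; Equivalence; mk⇔)
open import Function.Definitions using (Injective)
open import Induction.WellFounded using (Acc; acc)
open import Relation.Binary.Definitions using (DecidableEquality; tri<; tri≈; tri>)
open import Relation.Binary.PropositionalEquality
open import Relation.Nullary using (¬_; yes; no; contradiction)
open import Relation.Unary using (Decidable)

least-witness : ∀ {P : ℕ → Set} → Decidable P → ∀ k → P k →
                ∃ λ m → P m × (∀ {s} → s < m → ¬ P s)
least-witness P? k pk with P? 0
... | yes p0 = 0 , p0 , λ ()
least-witness P? zero    pk | no ¬p0 = contradiction pk ¬p0
least-witness P? (suc k) pk | no ¬p0 with least-witness (P? ∘ suc) k pk
... | m , pm , below = suc m , pm , λ { {zero} _ → ¬p0 ; {suc s} s<m → below (≤-pred s<m) }

allPairs-lookup : ∀ {A : Set} {R : A → A → Set} {xs : List A} → AllPairs R xs →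
                  ∀ {i j} → toℕ i < toℕ j → R (List.lookup xs i) (List.lookup xs j)
allPairs-lookup (Rx ∷ _)  {zero}  {suc j} _         = All.lookup Rx (∈-lookup j)
allPairs-lookup (_ ∷ Rxs) {suc i} {suc j} (s≤s i<j) = allPairs-lookup Rxs i<j

module _ {A : Set} {N : ℕ} (xs : List A) (N≡ : N ≡ length xs) where

  enumerate : Fin N → A
  enumerate i = List.lookup xs (cast N≡ i)

  enumerate-∈ : ∀ i → enumerate i ∈ₗ xs
  enumerate-∈ i = ∈-lookup (cast N≡ i)

  enumerate-surjective : ∀ {x} → x ∈ₗ xs → ∃ λ i → enumerate i ≡ x
  enumerate-surjective x∈ = cast (sym N≡) (Any.index x∈) ,
    trans (cong (List.lookup xs) (cast-involutive N≡ (sym N≡) _)) (sym (lookup-index x∈))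

  cast-< : ∀ {i j} → toℕ i < toℕ j → toℕ (cast N≡ i) < toℕ (cast N≡ j)
  cast-< {i} {j} = subst₂ _<_ (sym (toℕ-cast N≡ i)) (sym (toℕ-cast N≡ j))

  enumerate-injective : Unique xs → Injective _≡_ _≡_ enumerate
  enumerate-injective u {i} {j} eq with <-cmp (toℕ i) (toℕ j)
  ... | tri< i<j _ _ = contradiction eq (allPairs-lookup u (cast-< i<j))
  ... | tri≈ _ i≡j _ = toℕ-injective i≡j
  ... | tri> _ _ j<i = contradiction (sym eq) (allPairs-lookup u (cast-< j<i))

  enumerate-monotone : ∀ {R : A → A → Set} → (∀ {x} → R x x) → AllPairs R xs →
                       ∀ i j → toℕ i ≤ toℕ j → R (enumerate i) (enumerate j)
  enumerate-monotone {R} R-refl Rxs i j i≤j with m≤n⇒m<n∨m≡n i≤j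
  ... | inj₁ i<j = allPairs-lookup Rxs (cast-< i<j)
  ... | inj₂ i≡j = subst (λ k → R (enumerate i) (enumerate k)) (toℕ-injective i≡j) R-refl

-- Covers p X: X may stand at position p of the enumeration.
module CyclicArrangement
  {A : Set} (_≟_ : DecidableEquality A)
  (σ : A → A) (n : ℕ) (σ-cycle : ∀ X → fold X σ (suc n) ≡ X)
  (w : A → ℕ) (w-σ : ∀ X → w (σ X) ≡ w X)
  (Covers : ℕ → A → Set) (Covers-σ : ∀ {p X} → Covers p X → Covers (suc p) (σ X))
  where

  open import Data.List.Membership.DecPropositional _≟_ using (_∈?_; _∉?_)

  σ^ : ℕ → A → A
  σ^ t X = fold X σ t

  σ^-+ : ∀ a b X → σ^ (a + b) X ≡ σ^ a (σ^ b X)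
  σ^-+ a b X = fold-+ X σ a

  σ^n∘σ≡id : ∀ X → σ^ n (σ X) ≡ X
  σ^n∘σ≡id X = begin
    σ^ n (σ X)    ≡⟨ σ^-+ n 1 X ⟨
    σ^ (n + 1) X  ≡⟨ cong (λ t → σ^ t X) (+-comm n 1) ⟩
    σ^ (suc n) X  ≡⟨ σ-cycle X ⟩
    X             ∎
    where open ≡-Reasoning

  σ-injective : ∀ {X Y} → σ X ≡ σ Y → X ≡ Y
  σ-injective {X} {Y} eq = trans (sym (σ^n∘σ≡id X)) (trans (cong (σ^ n) eq) (σ^n∘σ≡id Y))

  σ^-injective : ∀ t {X Y} → σ^ t X ≡ σ^ t Y → X ≡ Y
  σ^-injective zero    eq = eq
  σ^-injective (suc t) eq = σ^-injective t (σ-injective eq)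

  w-σ^ : ∀ t X → w (σ^ t X) ≡ w X
  w-σ^ zero    X = refl
  w-σ^ (suc t) X = trans (w-σ (σ^ t X)) (w-σ^ t X)

  Covers-σ^ : ∀ t {p X} → Covers p X → Covers (p + t) (σ^ t X)
  Covers-σ^ zero    {p} {X} c = subst (λ q → Covers q X) (sym (+-identityʳ p)) c
  Covers-σ^ (suc t) {p} {X} c =
    subst (λ q → Covers q (σ^ (suc t) X)) (sym (+-suc p t)) (Covers-σ (Covers-σ^ t c))

  Sorted : List A → Set
  Sorted = AllPairs (λ Y Z → w Y ≤ w Z)

  data Aligned : ℕ → List A → Set where
    []  : ∀ {p} → Aligned p []
    _∷_ : ∀ {p X Xs} → Covers p X → Aligned (suc p) Xs → Aligned p (X ∷ Xs)

  applyUpTo-aligned : ∀ {p} f k → (∀ t → Covers (p + t) (f t)) → Aligned p (applyUpTo f k)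
  applyUpTo-aligned     f zero    c = []
  applyUpTo-aligned {p} f (suc k) c =
    subst (λ q → Covers q (f 0)) (+-identityʳ p) (c 0) ∷
    applyUpTo-aligned (f ∘ suc) k (λ t → subst (λ q → Covers q (f (suc t))) (+-suc p t) (c (suc t)))

  ++-aligned : ∀ {p Xs Ys} → Aligned p Xs → Aligned (p + length Xs) Ys → Aligned p (Xs ++ Ys)
  ++-aligned {p} {Ys = Ys} []       a = subst (λ q → Aligned q Ys) (+-identityʳ p) a
  ++-aligned {p} {Ys = Ys} (c ∷ cs) a = c ∷ ++-aligned cs (subst (λ q → Aligned q Ys) (+-suc p _) a)

  aligned-lookup : ∀ {p Xs} → Aligned p Xs → ∀ i → Covers (p + toℕ i) (List.lookup Xs i)
  aligned-lookup {p} {X ∷ _}  (c ∷ _)  zero    = subst (λ q → Covers q X) (sym (+-identityʳ p)) c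
  aligned-lookup {p} {_ ∷ Xs} (_ ∷ cs) (suc i) =
    subst (λ q → Covers q (List.lookup Xs i)) (sym (+-suc p (toℕ i))) (aligned-lookup cs i)

  aligned-enumerate : ∀ {N Xs} → Aligned 0 Xs → (N≡ : N ≡ length Xs) →
                      ∀ i → Covers (toℕ i) (enumerate Xs N≡ i)
  aligned-enumerate {Xs = Xs} a N≡ i =
    subst (λ q → Covers q (enumerate Xs N≡ i)) (toℕ-cast N≡ i) (aligned-lookup a (cast N≡ i))

  firstReturn : ∀ X → ∃ λ last → σ^ (suc last) X ≡ X × (∀ {s} → s < last → σ^ (suc s) X ≢ X)
  firstReturn X = least-witness (λ s → σ^ (suc s) X ≟ X) n (σ-cycle X)

  Closed : List A → Set
  Closed R = ∀ {Y} → Y ∈ₗ R → σ Y ∈ₗ R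

  σ^-closed : ∀ {R} → Closed R → ∀ t {X} → X ∈ₗ R → σ^ t X ∈ₗ R
  σ^-closed closed zero    X∈R = X∈R
  σ^-closed closed (suc t) X∈R = closed (σ^-closed closed t X∈R)

  module Orbit (X : A) where

    last : ℕ
    last = proj₁ (firstReturn X)

    orbit : List A
    orbit = applyUpTo (λ t → σ^ t X) (suc last)

    orbit-unique : Unique orbit
    orbit-unique = Unique.applyUpTo⁺₁ _ (suc last) distinct
      where
      distinct : ∀ {i j} → i < j → j < suc last → σ^ i X ≢ σ^ j X
      distinct {i} i<j j≤last with m≤n⇒∃[o]m+o≡n i<j
      ... | c , refl = λ eq → proj₂ (proj₂ (firstReturn X)) c<last (sym (σ^-injective i (begin
        σ^ i X              ≡⟨ eq ⟩
        σ^ (suc i + c) X    ≡⟨ cong (λ t → σ^ t X) (+-suc i c) ⟨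
        σ^ (i + suc c) X    ≡⟨ σ^-+ i (suc c) X ⟩
        σ^ i (σ^ (suc c) X) ∎)))
        where
        open ≡-Reasoning
        c<last : c < last
        c<last = ≤-trans (s≤s (m≤n+m c i)) (≤-pred j≤last)

    σ-∈orbit⁻ : ∀ {Y} → σ Y ∈ₗ orbit → Y ∈ₗ orbit
    σ-∈orbit⁻ σY∈ with ∈-applyUpTo⁻ (λ t → σ^ t X) σY∈
    ... | zero  , _ , σY≡X =
      subst (_∈ₗ orbit) (σ-injective (trans (proj₁ (proj₂ (firstReturn X))) (sym σY≡X)))
        (∈-applyUpTo⁺ (λ t → σ^ t X) ≤-refl)
    ... | suc t , t<1+last , σY≡σᵗ⁺¹X =
      subst (_∈ₗ orbit) (σ-injective (sym σY≡σᵗ⁺¹X))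
        (∈-applyUpTo⁺ (λ t → σ^ t X) (<-trans (n<1+n t) t<1+last))

    orbit-⊆ : ∀ {R} → Closed R → X ∈ₗ R → ∀ {Y} → Y ∈ₗ orbit → Y ∈ₗ R
    orbit-⊆ closed X∈R Y∈ with ∈-applyUpTo⁻ (λ t → σ^ t X) Y∈
    ... | t , _ , refl = σ^-closed closed t X∈R

    orbit-aligned : ∀ {p} → Covers p X → Aligned p orbit
    orbit-aligned c = applyUpTo-aligned _ (suc last) (λ t → Covers-σ^ t c)

    orbit-weight : ∀ {Y} → Y ∈ₗ orbit → w Y ≡ w X
    orbit-weight Y∈ with ∈-applyUpTo⁻ (λ t → σ^ t X) Y∈
    ... | t , _ , refl = w-σ^ t X

    orbit-sorted : Sorted orbit
    orbit-sorted = AllPairs.applyUpTo⁺₂ _ (suc last)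
      λ i j → ≤-reflexive (trans (w-σ^ i X) (sym (w-σ^ j X)))

  open Orbit using (orbit; orbit-unique; σ-∈orbit⁻; orbit-⊆; orbit-aligned; orbit-weight; orbit-sorted)

  ++-filter∉-∼set : ∀ {o R Ls} → (∀ {Y} → Y ∈ₗ o → Y ∈ₗ R) →
                    Ls ∼[ set ] filter (_∉? o) R → (o ++ Ls) ∼[ set ] R
  ++-filter∉-∼set {o} {R} {Ls} o⊆R Ls∼ = mk⇔ to from
    where
    to : ∀ {Y} → Y ∈ₗ o ++ Ls → Y ∈ₗ R
    to Y∈ with ∈-++⁻ o Y∈
    ... | inj₁ Y∈o  = o⊆R Y∈o
    ... | inj₂ Y∈Ls = proj₁ (∈-filter⁻ (_∉? o) (Equivalence.to Ls∼ Y∈Ls))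
    from : ∀ {Y} → Y ∈ₗ R → Y ∈ₗ o ++ Ls
    from {Y} Y∈R with Y ∈? o
    ... | yes Y∈o = ∈-++⁺ˡ Y∈o
    ... | no  Y∉o = ∈-++⁺ʳ o (Equivalence.from Ls∼ (∈-filter⁺ (_∉? o) Y∈R Y∉o))

  lightest : ∀ H Hs → ∃ λ M → M ∈ₗ H ∷ Hs × All (λ Z → w M ≤ w Z) (H ∷ Hs)
  lightest H Hs = argmin w H Hs , M∈ , f[argmin]≤f[⊤] {f = w} H Hs ∷ f[argmin]≤f[xs] {f = w} H Hs
    where
    M∈ : argmin w H Hs ∈ₗ H ∷ Hs
    M∈ with argmin-sel w H Hs
    ... | inj₁ M≡H  = here M≡H
    ... | inj₂ M∈Hs = there M∈Hs

  Alignable : A → Set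
  Alignable X = ∀ p → ∃ λ t → Covers p (σ^ t X)

  record Family (R : List A) : Set where
    field
      unique    : Unique R
      closed    : Closed R
      alignable : ∀ {X} → X ∈ₗ R → Alignable X

  remove-orbit : ∀ {R X} → Family R → Family (filter (_∉? orbit X) R)
  remove-orbit {R} {X} F = record
    { unique    = Unique.filter⁺ (_∉? orbit X) unique
    ; closed    = λ Y∈ → let Y∈R , Y∉o = ∈-filter⁻ (_∉? orbit X) Y∈ in
                         ∈-filter⁺ (_∉? orbit X) (closed Y∈R) (Y∉o ∘ σ-∈orbit⁻ X)
    ; alignable = alignable ∘ proj₁ ∘ ∈-filter⁻ (_∉? orbit X)
    }
    where open Family F

  record Arrangement (p : ℕ) (R Ls : List A) : Set where
    field
      unique  : Unique Ls
      members : Ls ∼[ set ] R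
      aligned : Aligned p Ls
      sorted  : Sorted Ls

  length-arrangement : ∀ {p R Ls} → Unique R → Arrangement p R Ls → length R ≡ length Ls
  length-arrangement uR arr = sym (↭-length (∼bag⇒↭ (unique∧set⇒bag unique uR members)))
    where open Arrangement arr

  -- Each orbit is started from a translate of a lightest remaining set, which keeps the list sorted.
  arrange : ∀ p R → Acc _<_ (length R) → Family R → ∃ (Arrangement p R)
  arrange p []           _         _ =
    [] , record { unique = [] ; members = mk⇔ (λ ()) (λ ()) ; aligned = [] ; sorted = [] }
  arrange p R@(H ∷ Hs) (acc rec) F = orbit X ++ Ls , record
    { unique  = Unique.++⁺ (orbit-unique X) unique λ (Y∈o , Y∈Ls) → proj₂ (left Y∈Ls) Y∈o
    ; members = ++-filter∉-∼set (orbit-⊆ X closed X∈R) members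
    ; aligned = ++-aligned (orbit-aligned X X-covers) aligned
    ; sorted  = AllPairs.++⁺ (orbit-sorted X) sorted (All.tabulate λ Y∈o → All.tabulate λ Z∈Ls → begin
        w _ ≡⟨ orbit-weight X Y∈o ⟩
        w X ≡⟨ w-σ^ t M ⟩
        w M ≤⟨ All.lookup M-lightest (proj₁ (left Z∈Ls)) ⟩
        w _ ∎)
    }
    where
    open ≤-Reasoning
    open Family F using (closed; alignable)
    M : A
    M = proj₁ (lightest H Hs)
    M∈R : M ∈ₗ R
    M∈R = proj₁ (proj₂ (lightest H Hs))
    M-lightest : All (λ Z → w M ≤ w Z) R
    M-lightest = proj₂ (proj₂ (lightest H Hs))
    t : ℕ
    t = proj₁ (alignable M∈R p)
    X : A
    X = σ^ t M
    X-covers : Covers p X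
    X-covers = proj₂ (alignable M∈R p)
    X∈R : X ∈ₗ R
    X∈R = σ^-closed closed t M∈R
    rest : List A
    rest = filter (_∉? orbit X) R
    shorter : length rest < length R
    shorter = filter-notAll (_∉? orbit X) R (Any.map (λ { refl X∉o → X∉o (here refl) }) X∈R)
    arranged-rest : ∃ (Arrangement (p + length (orbit X)) rest)
    arranged-rest = arrange (p + length (orbit X)) rest (rec shorter) (remove-orbit F)
    Ls : List A
    Ls = proj₁ arranged-rest
    open Arrangement (proj₂ arranged-rest)
    left : ∀ {Y} → Y ∈ₗ Ls → Y ∈ₗ R × Y ∉ₗ orbit X
    left = ∈-filter⁻ (_∉? orbit X) ∘ Equivalence.to members

subsets : ∀ k → List (Subset k)
subsets zero    = [] ∷ []
subsets (suc k) = map (inside ∷_) (subsets k) ++ map (outside ∷_) (subsets k)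

nonemptySubsets : ∀ k → List (Subset k)
nonemptySubsets zero    = []
nonemptySubsets (suc k) = map (inside ∷_) (subsets k) ++ map (outside ∷_) (nonemptySubsets k)

length-subsets : ∀ k → length (subsets k) ≡ 2 ^ k
length-subsets zero    = refl
length-subsets (suc k) = begin
  length (map (inside ∷_) (subsets k) ++ map (outside ∷_) (subsets k))
    ≡⟨ length-++ (map (inside ∷_) (subsets k)) ⟩
  length (map (inside ∷_) (subsets k)) + length (map (outside ∷_) (subsets k))
    ≡⟨ cong₂ _+_ (length-map (inside ∷_) (subsets k)) (length-map (outside ∷_) (subsets k)) ⟩
  length (subsets k) + length (subsets k)
    ≡⟨ cong₂ _+_ (length-subsets k) (trans (length-subsets k) (sym (+-identityʳ _))) ⟩
  2 ^ suc k ∎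
  where open ≡-Reasoning

length-nonemptySubsets : ∀ k → length (nonemptySubsets k) ≡ 2 ^ k ∸ 1
length-nonemptySubsets zero    = refl
length-nonemptySubsets (suc k) = begin
  length (map (inside ∷_) (subsets k) ++ map (outside ∷_) (nonemptySubsets k))
    ≡⟨ length-++ (map (inside ∷_) (subsets k)) ⟩
  length (map (inside ∷_) (subsets k)) + length (map (outside ∷_) (nonemptySubsets k))
    ≡⟨ cong₂ _+_ (trans (length-map (inside ∷_) (subsets k)) (length-subsets k))
                 (trans (length-map (outside ∷_) (nonemptySubsets k)) (length-nonemptySubsets k)) ⟩
  2 ^ k + (2 ^ k ∸ 1)
    ≡⟨ +-∸-assoc (2 ^ k) (m^n>0 2 k) ⟨
  2 ^ k + 2 ^ k ∸ 1
    ≡⟨ cong (λ m → 2 ^ k + m ∸ 1) (+-identityʳ (2 ^ k)) ⟨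
  2 ^ suc k ∸ 1 ∎
  where open ≡-Reasoning

inside∷-outside∷-disjoint : ∀ {k} {Xs Ys : List (Subset k)} →
                            Disjoint (map (inside ∷_) Xs) (map (outside ∷_) Ys)
inside∷-outside∷-disjoint (X∈ , Y∈) with ∈-map⁻ (inside ∷_) X∈ | ∈-map⁻ (outside ∷_) Y∈
... | _ , _ , refl | _ , _ , ()

subsets-unique : ∀ k → Unique (subsets k)
subsets-unique zero    = [] ∷ []
subsets-unique (suc k) = Unique.++⁺ (Unique.map⁺ ∷-injectiveʳ (subsets-unique k))
  (Unique.map⁺ ∷-injectiveʳ (subsets-unique k)) inside∷-outside∷-disjoint

nonemptySubsets-unique : ∀ k → Unique (nonemptySubsets k)
nonemptySubsets-unique zero    = []
nonemptySubsets-unique (suc k) = Unique.++⁺ (Unique.map⁺ ∷-injectiveʳ (subsets-unique k))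
  (Unique.map⁺ ∷-injectiveʳ (nonemptySubsets-unique k)) inside∷-outside∷-disjoint

∈-subsets : ∀ {k} (X : Subset k) → X ∈ₗ subsets k
∈-subsets []            = here refl
∈-subsets (inside  ∷ X) = ∈-++⁺ˡ (∈-map⁺ (inside ∷_) (∈-subsets X))
∈-subsets (outside ∷ X) = ∈-++⁺ʳ (map (inside ∷_) (subsets _)) (∈-map⁺ (outside ∷_) (∈-subsets X))

∈-nonemptySubsets⁺ : ∀ {k} {X : Subset k} → Nonempty X → X ∈ₗ nonemptySubsets k
∈-nonemptySubsets⁺ {X = inside  ∷ X} _                  = ∈-++⁺ˡ (∈-map⁺ (inside ∷_) (∈-subsets X))
∈-nonemptySubsets⁺ {X = outside ∷ X} (suc j , there j∈) =
  ∈-++⁺ʳ (map (inside ∷_) (subsets _)) (∈-map⁺ (outside ∷_) (∈-nonemptySubsets⁺ (j , j∈)))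

∈-nonemptySubsets⁻ : ∀ {k} {X : Subset k} → X ∈ₗ nonemptySubsets k → Nonempty X
∈-nonemptySubsets⁻ {suc k} X∈ with ∈-++⁻ (map (inside ∷_) (subsets k)) X∈
... | inj₁ X∈ᵢ with ∈-map⁻ (inside ∷_) X∈ᵢ
...   | _ , _ , refl = zero , here
∈-nonemptySubsets⁻ {suc k} X∈ | inj₂ X∈ₒ with ∈-map⁻ (outside ∷_) X∈ₒ
...   | _ , Y∈ , refl with ∈-nonemptySubsets⁻ Y∈
...     | j , j∈ = suc j , there j∈

mod-toℕ : ∀ {d} p .{{_ : NonZero d}} (j : Fin d) → p % d ≡ toℕ j → p mod d ≡ j
mod-toℕ p j eq = toℕ-injective (trans (toℕ-fromℕ< _) eq)

mod-cong : ∀ {d} p q .{{_ : NonZero d}} → p % d ≡ q % d → p mod d ≡ q mod d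
mod-cong {d} p q eq = mod-toℕ p (q mod d) (trans eq (sym (toℕ-fromℕ< _)))

[m%n+k]%n≡[m+k]%n : ∀ m k n .{{_ : NonZero n}} → (m % n + k) % n ≡ (m + k) % n
[m%n+k]%n≡[m+k]%n m k n = begin
  (m % n + k) % n          ≡⟨ %-distribˡ-+ (m % n) k n ⟩
  (m % n % n + k % n) % n  ≡⟨ cong (λ x → (x + k % n) % n) (m%n%n≡m%n m n) ⟩
  (m % n + k % n) % n      ≡⟨ %-distribˡ-+ m k n ⟨
  (m + k) % n              ∎
  where open ≡-Reasoning

lookup-∷ʳ-< : ∀ {A : Set} {n} (xs : Vec A n) x i (i<n : toℕ i < n) →
              lookup (xs ∷ʳ x) i ≡ lookup xs (fromℕ< i<n)
lookup-∷ʳ-< (y ∷ ys) x zero    i<n = refl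
lookup-∷ʳ-< (y ∷ ys) x (suc i) i<n = lookup-∷ʳ-< ys x i (≤-pred i<n)

lookup-∷ʳ-≡ : ∀ {A : Set} {n} (xs : Vec A n) x i → toℕ i ≡ n → lookup (xs ∷ʳ x) i ≡ x
lookup-∷ʳ-≡ []       x zero    _   = refl
lookup-∷ʳ-≡ (y ∷ ys) x (suc i) i≡n = lookup-∷ʳ-≡ ys x i (suc-injective i≡n)

rotˡ : ∀ {A : Set} {n} → Vec A (suc n) → Vec A (suc n)
rotˡ (x ∷ xs) = xs ∷ʳ x

lookup-rotˡ : ∀ {A : Set} {n} (X : Vec A (suc n)) i →
              lookup (rotˡ X) i ≡ lookup X (suc (toℕ i) mod suc n)
lookup-rotˡ {n = n} (x ∷ xs) i with m<1+n⇒m<n∨m≡n (toℕ<n i)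
... | inj₁ i<n = trans (lookup-∷ʳ-< xs x i i<n) (cong (lookup (x ∷ xs)) (sym next))
  where
  next : suc (toℕ i) mod suc n ≡ suc (fromℕ< i<n)
  next = mod-toℕ (suc (toℕ i)) _ (trans (m<n⇒m%n≡m (s≤s i<n)) (cong suc (sym (toℕ-fromℕ< i<n))))
... | inj₂ i≡n = trans (lookup-∷ʳ-≡ xs x i i≡n) (cong (lookup (x ∷ xs)) (sym wrap))
  where
  wrap : suc (toℕ i) mod suc n ≡ zero
  wrap = mod-toℕ (suc (toℕ i)) zero (trans (cong (λ m → suc m % suc n) i≡n) (n%n≡0 (suc n)))

∣∷ʳ∣ : ∀ {n} x (xs : Subset n) → ∣ xs ∷ʳ x ∣ ≡ ∣ x ∷ xs ∣
∣∷ʳ∣ x       []             = refl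
∣∷ʳ∣ outside (outside ∷ xs) = ∣∷ʳ∣ outside xs
∣∷ʳ∣ outside (inside  ∷ xs) = cong suc (∣∷ʳ∣ outside xs)
∣∷ʳ∣ inside  (outside ∷ xs) = ∣∷ʳ∣ inside xs
∣∷ʳ∣ inside  (inside  ∷ xs) = cong suc (∣∷ʳ∣ inside xs)

module Rotation (n : ℕ) where

  lookup-rotˡ^ : ∀ {A : Set} k (X : Vec A (suc n)) i →
                 lookup (fold X rotˡ k) i ≡ lookup X ((toℕ i + k) mod suc n)
  lookup-rotˡ^ zero    X i = cong (lookup X) (sym (mod-toℕ (toℕ i + 0) i
    (trans (cong (_% suc n) (+-identityʳ (toℕ i))) (m<n⇒m%n≡m (toℕ<n i)))))
  lookup-rotˡ^ (suc k) X i = trans (lookup-rotˡ (fold X rotˡ k) i) (trans (lookup-rotˡ^ k X _)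
    (cong (lookup X) (mod-cong (toℕ (suc (toℕ i) mod suc n) + k) (toℕ i + suc k) (begin
      (toℕ (suc (toℕ i) mod suc n) + k) % suc n
        ≡⟨ cong (λ m → (m + k) % suc n) (toℕ-fromℕ< (m%n<n (suc (toℕ i)) (suc n))) ⟩
      (suc (toℕ i) % suc n + k) % suc n
        ≡⟨ [m%n+k]%n≡[m+k]%n (suc (toℕ i)) k (suc n) ⟩
      (suc (toℕ i) + k) % suc n
        ≡⟨ cong (_% suc n) (+-suc (toℕ i) k) ⟨
      (toℕ i + suc k) % suc n ∎))))
    where open ≡-Reasoning

  ∣rotˡ^∣ : ∀ k (X : Subset (suc n)) → ∣ fold X rotˡ k ∣ ≡ ∣ X ∣
  ∣rotˡ^∣ zero    X = refl
  ∣rotˡ^∣ (suc k) X with fold X rotˡ k | ∣rotˡ^∣ k X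
  ... | x ∷ xs | eq = trans (∣∷ʳ∣ x xs) eq

  -- The right rotation is taken to be n left rotations, so that it inherits their size invariance.
  rotʳ : ∀ {A : Set} → Vec A (suc n) → Vec A (suc n)
  rotʳ X = fold X rotˡ n

  rotʳ^ : ∀ {A : Set} t (X : Vec A (suc n)) → fold X rotʳ t ≡ fold X rotˡ (t * n)
  rotʳ^ zero    X = refl
  rotʳ^ (suc t) X = trans (cong rotʳ (rotʳ^ t X)) (sym (fold-+ X rotˡ n))

  rotʳ-cycle : ∀ {A : Set} (X : Vec A (suc n)) → fold X rotʳ (suc n) ≡ X
  rotʳ-cycle X = begin
    fold X rotʳ (suc n)                          ≡⟨ rotʳ^ (suc n) X ⟩
    fold X rotˡ (suc n * n)                      ≡⟨ tabulate∘lookup _ ⟨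
    tabulate (lookup (fold X rotˡ (suc n * n)))  ≡⟨ tabulate-cong full-turn ⟩
    tabulate (lookup X)                          ≡⟨ tabulate∘lookup X ⟩
    X                                            ∎
    where
    open ≡-Reasoning
    full-turn : ∀ i → lookup (fold X rotˡ (suc n * n)) i ≡ lookup X i
    full-turn i = trans (lookup-rotˡ^ (suc n * n) X i) (cong (lookup X) (mod-toℕ (toℕ i + suc n * n) i
      (trans (cong (λ m → (toℕ i + m) % suc n) (*-comm (suc n) n))
             (trans ([m+kn]%n≡m%n (toℕ i) n (suc n)) (m<n⇒m%n≡m (toℕ<n i))))))

  ∣rotʳ∣ : ∀ X → ∣ rotʳ X ∣ ≡ ∣ X ∣
  ∣rotʳ∣ = ∣rotˡ^∣ n

  -- Position p of the enumeration (counted from 0) must contain the element p mod (suc n).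
  Covers : ℕ → Subset (suc n) → Set
  Covers p X = p mod suc n ∈ X

  Covers-resp : ∀ p q {X} → p % suc n ≡ q % suc n → Covers p X → Covers q X
  Covers-resp p q {X} eq = subst (_∈ X) (mod-cong p q eq)

  Covers-toℕ : ∀ {j X} → j ∈ X → Covers (toℕ j) X
  Covers-toℕ {j} {X} = subst (_∈ X) (sym (mod-toℕ (toℕ j) j (m<n⇒m%n≡m (toℕ<n j))))

  Covers⇒∈ : ∀ {X} j k → Covers (toℕ j + k * suc n) X → j ∈ X
  Covers⇒∈ {X} j k = subst (_∈ X) (mod-toℕ (toℕ j + k * suc n) j
    (trans ([m+kn]%n≡m%n (toℕ j) k (suc n)) (m<n⇒m%n≡m (toℕ<n j))))

  Covers-rotʳ : ∀ {p X} → Covers p X → Covers (suc p) (rotʳ X)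
  Covers-rotʳ {p} {X} c = lookup⇒[]= _ (rotʳ X) (begin
    lookup (rotʳ X) (suc p mod suc n)
      ≡⟨ lookup-rotˡ^ n X _ ⟩
    lookup X ((toℕ (suc p mod suc n) + n) mod suc n)
      ≡⟨ cong (lookup X) (mod-cong (toℕ (suc p mod suc n) + n) p one-step) ⟩
    lookup X (p mod suc n)
      ≡⟨ []=⇒lookup c ⟩
    true ∎)
    where
    open ≡-Reasoning
    one-step : (toℕ (suc p mod suc n) + n) % suc n ≡ p % suc n
    one-step = begin
      (toℕ (suc p mod suc n) + n) % suc n  ≡⟨ cong (λ m → (m + n) % suc n) (toℕ-fromℕ< (m%n<n (suc p) (suc n))) ⟩
      (suc p % suc n + n) % suc n          ≡⟨ [m%n+k]%n≡[m+k]%n (suc p) n (suc n) ⟩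
      (suc p + n) % suc n                  ≡⟨ cong (_% suc n) (+-suc p n) ⟨
      (p + suc n) % suc n                  ≡⟨ [m+n]%n≡m%n p (suc n) ⟩
      p % suc n                            ∎

  open CyclicArrangement (≡-dec Bool._≟_) rotʳ n rotʳ-cycle ∣_∣ ∣rotʳ∣ Covers Covers-rotʳ public

  nonempty-rotʳ : ∀ {X} → Nonempty X → Nonempty (rotʳ X)
  nonempty-rotʳ (j , j∈X) = _ , Covers-rotʳ {toℕ j} (Covers-toℕ j∈X)

  nonempty⇒alignable : ∀ {X} → Nonempty X → Alignable X
  nonempty⇒alignable (j , j∈X) p =
    t , Covers-resp (toℕ j + t) p lands (Covers-σ^ t {toℕ j} (Covers-toℕ j∈X))
    where
    t = p + toℕ j * n
    lands : (toℕ j + t) % suc n ≡ p % suc n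
    lands = trans (cong (_% suc n) (begin
      toℕ j + (p + toℕ j * n)  ≡⟨ +-assoc (toℕ j) p _ ⟨
      toℕ j + p + toℕ j * n    ≡⟨ cong (_+ toℕ j * n) (+-comm (toℕ j) p) ⟩
      p + toℕ j + toℕ j * n    ≡⟨ +-assoc p (toℕ j) _ ⟩
      p + (toℕ j + toℕ j * n)  ≡⟨ cong (p +_) (*-suc (toℕ j) n) ⟨
      p + toℕ j * suc n        ∎)) ([m+kn]%n≡m%n p (toℕ j) (suc n))
      where open ≡-Reasoning

  nonemptySubsets-family : Family (nonemptySubsets (suc n))
  nonemptySubsets-family = record
    { unique    = nonemptySubsets-unique (suc n)
    ; closed    = ∈-nonemptySubsets⁺ ∘ nonempty-rotʳ ∘ ∈-nonemptySubsets⁻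
    ; alignable = nonempty⇒alignable ∘ ∈-nonemptySubsets⁻
    }

lemma7p2 : (d : ℕ) →
    Σ (Fin (2 ^ d ∸ 1) → Subset d) λ S →
      (∀ i → Nonempty (S i))
      × Injective _≡_ _≡_ S
      × (∀ (p : Subset d) → Nonempty p → ∃ λ i → S i ≡ p)
      × (∀ (i : Fin (2 ^ d ∸ 1)) (j : Fin d) →
           (∃ λ k → toℕ i ≡ toℕ j + k * d) → j ∈ S i)
      × (∀ (i j : Fin (2 ^ d ∸ 1)) → toℕ i ≤ toℕ j → ∣ S i ∣ ≤ ∣ S j ∣)
lemma7p2 zero    = (λ ()) , (λ ()) , (λ { {()} }) , (λ { [] (() , _) }) , (λ ()) , (λ ())
lemma7p2 (suc n) =
  S ,
  (λ i → ∈-nonemptySubsets⁻ (Equivalence.to members (enumerate-∈ Ls length≡ i))) ,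
  enumerate-injective Ls length≡ unique ,
  (λ X → enumerate-surjective Ls length≡ ∘ Equivalence.from members ∘ ∈-nonemptySubsets⁺) ,
  (λ i j (k , i≡j+kd) → Covers⇒∈ j k
     (subst (λ q → Covers q (S i)) i≡j+kd (aligned-enumerate aligned length≡ i))) ,
  enumerate-monotone Ls length≡ ≤-refl sorted
  where
  open Rotation n
  arrangement : ∃ (Arrangement 0 (nonemptySubsets (suc n)))
  arrangement = arrange 0 (nonemptySubsets (suc n)) (<-wellFounded _) nonemptySubsets-family
  Ls : List (Subset (suc n))
  Ls = proj₁ arrangement
  open Arrangement (proj₂ arrangement)
  length≡ : 2 ^ suc n ∸ 1 ≡ length Ls
  length≡ = trans (sym (length-nonemptySubsets (suc n)))
                  (length-arrangement (nonemptySubsets-unique (suc n)) (proj₂ arrangement))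
  S : Fin (2 ^ suc n ∸ 1) → Subset (suc n)
  S = enumerate Ls length≡
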